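{- Let $y\ge 0$ be an integer and let $n>2y$ be an odd integer. Consider the set of all $n$-words $w$ over the alphabet $\{0,1,2\}$ (ordered $0<1<2$) that contain exactly $2y$ occurrences of the letter $1$ and in which the number of occurrences of $0$ is larger than the number of occurrences of $2$. Let $w$ be a word in this set minimizing $m(3,w)$ over the set, and let $u$ be the subword of $w$ obtained by deleting all occurrences of $1$. Then $u$ is a consecutive subword (a contiguous block) of $w$. Furthermore, $w$ begins with $y$ letters $1$ and ends with $y$ letters $1$.
   Context: An $n$-word is a sequence $w=(w_1,\ldots,w_n)$ of letters. A subword is a subsequence $w_{i_1}\cdots w_{i_k}$ with $i_1<\cdots<i_k$ (counted by position sets); it is monotone if it is non-decreasing or non-increasing. $m(3,w)$ denotes the number of monotone $3$-subwords of $w$. -}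

module Defs where

open import Data.Nat using (ℕ; zero; suc; _+_; _*_; _≤_; _<_; _%_)
open import Data.Nat.Properties using (_≤?_)
open import Data.Fin using (Fin; toℕ; _≟_)
open import Data.List using (List; []; _∷_; [_]; _++_; map; filter; length; replicate)
open import Data.Product using (_×_; ∃; ∃-syntax)
open import Data.Sum using (_⊎_)
open import Relation.Nullary using (¬?)
open import Relation.Binary.PropositionalEquality using (_≡_)

Letter : Set
Letter = Fin 3

-- All k-subwords of a list, counted by position sets (with multiplicity).
subwords : {A : Set} → ℕ → List A → List (List A)
subwords zero    _        = [ [] ]
subwords (suc k) []       = []
subwords (suc k) (x ∷ xs) = map (x ∷_) (subwords k xs) ++ subwords (suc k) xs

data NonDecr : List Letter → Set where
  nd[]  : NonDecr []
  nd[_] : ∀ a → NonDecr [ a ]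
  nd∷   : ∀ {a b xs} → toℕ a ≤ toℕ b → NonDecr (b ∷ xs) → NonDecr (a ∷ b ∷ xs)

data NonIncr : List Letter → Set where
  ni[]  : NonIncr []
  ni[_] : ∀ a → NonIncr [ a ]
  ni∷   : ∀ {a b xs} → toℕ b ≤ toℕ a → NonIncr (b ∷ xs) → NonIncr (a ∷ b ∷ xs)

Monotone : List Letter → Set
Monotone u = NonDecr u ⊎ NonIncr u

open import Relation.Nullary using (Dec; yes; no)
open import Relation.Nullary.Decidable using (_⊎-dec_)

nonDecr? : (u : List Letter) → Dec (NonDecr u)
nonDecr? [] = yes nd[]
nonDecr? (a ∷ []) = yes nd[ a ]
nonDecr? (a ∷ b ∷ xs) with toℕ a ≤? toℕ b | nonDecr? (b ∷ xs)
... | yes p | yes q = yes (nd∷ p q)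
... | no ¬p | _     = no λ { (nd∷ p _) → ¬p p }
... | yes _ | no ¬q = no λ { (nd∷ _ q) → ¬q q }

nonIncr? : (u : List Letter) → Dec (NonIncr u)
nonIncr? [] = yes ni[]
nonIncr? (a ∷ []) = yes ni[ a ]
nonIncr? (a ∷ b ∷ xs) with toℕ b ≤? toℕ a | nonIncr? (b ∷ xs)
... | yes p | yes q = yes (ni∷ p q)
... | no ¬p | _     = no λ { (ni∷ p _) → ¬p p }
... | yes _ | no ¬q = no λ { (ni∷ _ q) → ¬q q }

monotone? : (u : List Letter) → Dec (Monotone u)
monotone? u = nonDecr? u ⊎-dec nonIncr? u

m3 : List Letter → ℕ
m3 w = length (filter monotone? (subwords 3 w))

occ : Letter → List Letter → ℕ
occ c w = length (filter (_≟ c) w)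

l0 l1 l2 : Letter
l0 = Fin.zero where import Data.Fin as Fin
l1 = Fin.suc Fin.zero where import Data.Fin as Fin
l2 = Fin.suc (Fin.suc Fin.zero) where import Data.Fin as Fin

InSet : ℕ → ℕ → List Letter → Set
InSet n y w = length w ≡ n × occ l1 w ≡ 2 * y × occ l2 w < occ l0 w

deleteOnes : List Letter → List Letter
deleteOnes w = filter (λ x → ¬? (x ≟ l1)) w

ConsecutiveIn : List Letter → List Letter → Set
ConsecutiveIn u w = ∃[ p ] ∃[ s ] (w ≡ p ++ u ++ s)

-- For a word w over {0,1,2} let m and e count its letters 0/2 and 1, and let the height of a word be
-- #0 − #2. At each position x compare what lies before and after it: the height gap
-- height(prefix) + sign(x) − height(suffix) and the ones gap #1(prefix) − #1(suffix). Then
--   48·m3(w) = C(m, e) + 6·Σ_{x≠1} (height gap)² + 12·Σ_{x=1} (height gap)² + 12·Σ_{x≠1} (ones gap)²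
-- for an explicit cubic C. When m is odd every height gap is odd, so the first two sums are at least
-- m and e; the word 1^y (02)^k 0 1^y attains all three lower bounds. A minimiser therefore has every
-- ones gap equal to 0: each letter 0 or 2 has exactly y ones on either side, which forces 1^y u 1^y.

module Submission where

open import Defs
open import Data.Nat as ℕ using (ℕ; zero; suc; z≤n; s≤s; _%_; _/_; _∸_)
open import Data.Nat.DivMod using (m≡m%n+[m/n]*n)
import Data.Nat.Properties as ℕ
open import Data.Fin using (zero; suc; _≟_)
open import Data.Integer using (ℤ; +_; -[1+_]; +[1+_]; _+_; _-_; _*_; -_; _≤_; +≤+; NonNegative; nonNegative)
open import Data.Integer.Properties
  using (pos-+; pos-*; +-injective; ≤-refl; +-identityˡ; +-assoc; *-identityˡ; i≤i+j; i≤j+i; i-j≡0⇒i≡j; *-cancelˡ-≡; ≤-trans; ≤-reflexive; +-mono-≤; +-monoʳ-≤; *-monoˡ-≤-nonNeg; *-identityʳ; *-zeroʳ; *-cancelˡ-≤-pos)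
open import Data.Integer.Tactic.RingSolver using (solve-∀)
open import Data.List using (List; []; _∷_; [_]; _++_; map; filter; length; replicate)
open import Data.List.Relation.Unary.All using (All; []; _∷_)
open import Data.List.Relation.Unary.All.Properties using (replicate⁺)
open import Data.List.Properties using (filter-++; length-++; map-++; length-filter; ++-assoc)
open import Data.Product using (_×_; _,_; proj₁; proj₂; ∃-syntax)
open import Data.Unit using (⊤; tt)
open import Data.Empty using (⊥-elim)
open import Relation.Nullary using (yes; no)
open import Relation.Binary.PropositionalEquality using (_≡_; refl; sym; trans; cong; cong₂; subst; subst₂; module ≡-Reasoning)
open ≡-Reasoning

sign isOne notOne : Letter → ℤ
sign   zero             = + 1
sign   (suc zero)       = + 0
sign   (suc (suc zero)) = -[1+ 0 ]
isOne  zero             = + 0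
isOne  (suc zero)       = + 1
isOne  (suc (suc zero)) = + 0
notOne zero             = + 1
notOne (suc zero)       = + 0
notOne (suc (suc zero)) = + 1

notOne-nonneg : ∀ x → NonNegative (notOne x)
notOne-nonneg zero             = _
notOne-nonneg (suc zero)       = _
notOne-nonneg (suc (suc zero)) = _

isOne-nonneg : ∀ x → NonNegative (isOne x)
isOne-nonneg zero             = _
isOne-nonneg (suc zero)       = _
isOne-nonneg (suc (suc zero)) = _

weight : (Letter → ℤ) → List Letter → ℤ
weight c []      = + 0
weight c (x ∷ w) = c x + weight c w

height : List Letter → ℤ
height = weight sign

weight-occ : ∀ c w → weight c w ≡ c l0 * + occ l0 w + c l1 * + occ l1 w + c l2 * + occ l2 w
weight-occ c [] = zeros (c l0) (c l1) (c l2)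
  where
  zeros : ∀ c₀ c₁ c₂ → + 0 ≡ c₀ * + 0 + c₁ * + 0 + c₂ * + 0
  zeros = solve-∀
weight-occ c (zero ∷ w) = trans (cong (_+_ (c l0)) (weight-occ c w)) (at0 (c l0) (c l1) (c l2) _ _ _)
  where
  at0 : ∀ c₀ c₁ c₂ o₀ o₁ o₂ → c₀ + (c₀ * o₀ + c₁ * o₁ + c₂ * o₂) ≡ c₀ * (+ 1 + o₀) + c₁ * o₁ + c₂ * o₂
  at0 = solve-∀
weight-occ c (suc zero ∷ w) = trans (cong (_+_ (c l1)) (weight-occ c w)) (at1 (c l0) (c l1) (c l2) _ _ _)
  where
  at1 : ∀ c₀ c₁ c₂ o₀ o₁ o₂ → c₁ + (c₀ * o₀ + c₁ * o₁ + c₂ * o₂) ≡ c₀ * o₀ + c₁ * (+ 1 + o₁) + c₂ * o₂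
  at1 = solve-∀
weight-occ c (suc (suc zero) ∷ w) = trans (cong (_+_ (c l2)) (weight-occ c w)) (at2 (c l0) (c l1) (c l2) _ _ _)
  where
  at2 : ∀ c₀ c₁ c₂ o₀ o₁ o₂ → c₂ + (c₀ * o₀ + c₁ * o₁ + c₂ * o₂) ≡ c₀ * o₀ + c₁ * o₁ + c₂ * (+ 1 + o₂)
  at2 = solve-∀

weight-isOne : ∀ w → weight isOne w ≡ + occ l1 w
weight-isOne w = trans (weight-occ isOne w) (select (+ occ l0 w) (+ occ l1 w) (+ occ l2 w))
  where
  select : ∀ o₀ o₁ o₂ → + 0 * o₀ + + 1 * o₁ + + 0 * o₂ ≡ o₁
  select = solve-∀

weight-notOne : ∀ w → weight notOne w ≡ height w + + 2 * + occ l2 w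
weight-notOne w = begin
  weight notOne w                                   ≡⟨ weight-occ notOne w ⟩
  + 1 * o₀ + + 0 * o₁ + + 1 * o₂                    ≡⟨ regroup o₀ o₁ o₂ ⟩
  (+ 1 * o₀ + + 0 * o₁ + -[1+ 0 ] * o₂) + + 2 * o₂  ≡⟨ cong (_+ + 2 * o₂) (sym (weight-occ sign w)) ⟩
  height w + + 2 * o₂                               ∎
  where
  o₀ = + occ l0 w
  o₁ = + occ l1 w
  o₂ = + occ l2 w
  regroup : ∀ o₀ o₁ o₂ → + 1 * o₀ + + 0 * o₁ + + 1 * o₂ ≡ (+ 1 * o₀ + + 0 * o₁ + -[1+ 0 ] * o₂) + + 2 * o₂
  regroup = solve-∀

height+occ₂ : ∀ w → height w + + occ l2 w ≡ + occ l0 w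
height+occ₂ w = trans (cong (_+ + occ l2 w) (weight-occ sign w)) (cancel (+ occ l0 w) (+ occ l1 w) (+ occ l2 w))
  where
  cancel : ∀ o₀ o₁ o₂ → + 1 * o₀ + + 0 * o₁ + -[1+ 0 ] * o₂ + o₂ ≡ o₀
  cancel = solve-∀

weight-length : ∀ w → weight (λ _ → + 1) w ≡ + length w
weight-length []      = refl
weight-length (_ ∷ w) = cong (_+_ (+ 1)) (weight-length w)

weight-notOne+isOne : ∀ w → weight notOne w + weight isOne w ≡ + length w
weight-notOne+isOne w = begin
  weight notOne w + weight isOne w
    ≡⟨ cong₂ _+_ (weight-occ notOne w) (weight-occ isOne w) ⟩
  (+ 1 * o₀ + + 0 * o₁ + + 1 * o₂) + (+ 0 * o₀ + + 1 * o₁ + + 0 * o₂)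
    ≡⟨ regroup o₀ o₁ o₂ ⟩
  + 1 * o₀ + + 1 * o₁ + + 1 * o₂
    ≡⟨ sym (weight-occ (λ _ → + 1) w) ⟩
  weight (λ _ → + 1) w
    ≡⟨ weight-length w ⟩
  + length w ∎
  where
  o₀ = + occ l0 w
  o₁ = + occ l1 w
  o₂ = + occ l2 w
  regroup : ∀ o₀ o₁ o₂ → (+ 1 * o₀ + + 0 * o₁ + + 1 * o₂) + (+ 0 * o₀ + + 1 * o₁ + + 0 * o₂) ≡ + 1 * o₀ + + 1 * o₁ + + 1 * o₂
  regroup = solve-∀

weight-++ : ∀ c xs ys → weight c (xs ++ ys) ≡ weight c xs + weight c ys
weight-++ c []       ys = sym (+-identityˡ (weight c ys))
weight-++ c (x ∷ xs) ys = trans (cong (_+_ (c x)) (weight-++ c xs ys)) (sym (+-assoc (c x) (weight c xs) (weight c ys)))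

weight-vanishing : ∀ {c w} → All (λ x → c x ≡ + 0) w → weight c w ≡ + 0
weight-vanishing []         = refl
weight-vanishing (cx≡0 ∷ p) = cong₂ _+_ cx≡0 (weight-vanishing p)

weight-replicate : ∀ c j x → weight c (replicate j x) ≡ + j * c x
weight-replicate c zero    x = refl
weight-replicate c (suc j) x = trans (cong (_+_ (c x)) (weight-replicate c j x)) (step (+ j) (c x))
  where
  step : ∀ j a → a + j * a ≡ (+ 1 + j) * a
  step = solve-∀

weight-decomposition : ∀ (c : Letter → ℤ) w →
  + 2 * weight c w ≡ (c l0 + c l2) * weight notOne w + (c l0 - c l2) * height w + + 2 * c l1 * weight isOne w
weight-decomposition c w = begin
  + 2 * weight c w
    ≡⟨ cong (+ 2 *_) (weight-occ c w) ⟩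
  + 2 * (c l0 * o₀ + c l1 * o₁ + c l2 * o₂)
    ≡⟨ regroup (c l0) (c l1) (c l2) o₀ o₁ o₂ ⟩
  (c l0 + c l2) * (+ 1 * o₀ + + 0 * o₁ + + 1 * o₂) + (c l0 - c l2) * (+ 1 * o₀ + + 0 * o₁ + -[1+ 0 ] * o₂)
    + + 2 * c l1 * (+ 0 * o₀ + + 1 * o₁ + + 0 * o₂)
    ≡⟨ sym (cong₂ _+_ (cong₂ _+_ (cong ((c l0 + c l2) *_) (weight-occ notOne w))
                                 (cong ((c l0 - c l2) *_) (weight-occ sign w)))
                      (cong (+ 2 * c l1 *_) (weight-occ isOne w))) ⟩
  (c l0 + c l2) * weight notOne w + (c l0 - c l2) * height w + + 2 * c l1 * weight isOne w ∎
  where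
  o₀ = + occ l0 w
  o₁ = + occ l1 w
  o₂ = + occ l2 w
  regroup : ∀ c₀ c₁ c₂ o₀ o₁ o₂ →
    + 2 * (c₀ * o₀ + c₁ * o₁ + c₂ * o₂)
      ≡ (c₀ + c₂) * (+ 1 * o₀ + + 0 * o₁ + + 1 * o₂) + (c₀ - c₂) * (+ 1 * o₀ + + 0 * o₁ + -[1+ 0 ] * o₂)
        + + 2 * c₁ * (+ 0 * o₀ + + 1 * o₁ + + 0 * o₂)
  regroup = solve-∀

-- Σ c(x)·(t − 2·weight g s) over the positions of a word, s being the suffix after x; for
-- t = weight g w the factor is weight g (prefix) + g x − weight g s.
imbalance : (Letter → ℤ) → (Letter → ℤ) → ℤ → List Letter → ℤ
imbalance c g t []      = + 0
imbalance c g t (x ∷ s) = c x * (t - + 2 * weight g s) + imbalance c g t s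

sqImbalance : (Letter → ℤ) → (Letter → ℤ) → ℤ → List Letter → ℤ
sqImbalance c g t []      = + 0
sqImbalance c g t (x ∷ s) = c x * ((t - + 2 * weight g s) * (t - + 2 * weight g s)) + sqImbalance c g t s

heightImbalance : (Letter → ℤ) → List Letter → ℤ
heightImbalance c w = sqImbalance c sign (height w) w

onesImbalance : List Letter → ℤ
onesImbalance w = sqImbalance notOne isOne (weight isOne w) w

imbalance-shift : ∀ c g r t w → imbalance c g (r + t) w ≡ imbalance c g t w + r * weight c w
imbalance-shift c g r t [] = base r
  where
  base : ∀ r → + 0 ≡ + 0 + r * + 0
  base = solve-∀
imbalance-shift c g r t (x ∷ s) =
  trans (cong (_+_ (c x * (r + t - + 2 * weight g s))) (imbalance-shift c g r t s))
        (step (c x) r t (weight g s) (imbalance c g t s) (weight c s))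
  where
  step : ∀ a r t h i v → a * (r + t - + 2 * h) + (i + r * v) ≡ a * (t - + 2 * h) + i + r * (a + v)
  step = solve-∀

sqImbalance-shift : ∀ c g r t w →
  sqImbalance c g (r + t) w ≡ sqImbalance c g t w + + 2 * r * imbalance c g t w + r * r * weight c w
sqImbalance-shift c g r t [] = base r
  where
  base : ∀ r → + 0 ≡ + 0 + + 2 * r * + 0 + r * r * + 0
  base = solve-∀
sqImbalance-shift c g r t (x ∷ s) =
  trans (cong (_+_ (c x * ((r + t - + 2 * weight g s) * (r + t - + 2 * weight g s)))) (sqImbalance-shift c g r t s))
        (step (c x) r t (weight g s) (sqImbalance c g t s) (imbalance c g t s) (weight c s))
  where
  step : ∀ a r t h q i v →
    a * ((r + t - + 2 * h) * (r + t - + 2 * h)) + (q + + 2 * r * i + r * r * v)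
      ≡ a * ((t - + 2 * h) * (t - + 2 * h)) + q + + 2 * r * (a * (t - + 2 * h) + i) + r * r * (a + v)
  step = solve-∀

imbalance-∷ : ∀ c g y t w →
  imbalance c g (g y + t) (y ∷ w) ≡ c y * (g y + t - + 2 * weight g w) + (imbalance c g t w + g y * weight c w)
imbalance-∷ c g y t w = cong (_+_ (c y * (g y + t - + 2 * weight g w))) (imbalance-shift c g (g y) t w)

sqImbalance-∷ : ∀ c g y t w →
  sqImbalance c g (g y + t) (y ∷ w)
    ≡ c y * ((g y + t - + 2 * weight g w) * (g y + t - + 2 * weight g w))
      + (sqImbalance c g t w + + 2 * g y * imbalance c g t w + g y * g y * weight c w)
sqImbalance-∷ c g y t w =
  cong (_+_ (c y * ((g y + t - + 2 * weight g w) * (g y + t - + 2 * weight g w)))) (sqImbalance-shift c g (g y) t w)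

sqImbalance-++ : ∀ c g t xs ys →
  sqImbalance c g t (xs ++ ys) ≡ sqImbalance c g (t - + 2 * weight g ys) xs + sqImbalance c g t ys
sqImbalance-++ c g t []       ys = sym (+-identityˡ (sqImbalance c g t ys))
sqImbalance-++ c g t (x ∷ xs) ys = begin
  c x * (q * q) + sqImbalance c g t (xs ++ ys)
    ≡⟨ cong₂ (λ h r → c x * ((t - + 2 * h) * (t - + 2 * h)) + r) (weight-++ g xs ys) (sqImbalance-++ c g t xs ys) ⟩
  c x * ((t - + 2 * (a + b)) * (t - + 2 * (a + b))) + (sqImbalance c g (t - + 2 * b) xs + sqImbalance c g t ys)
    ≡⟨ regroup (c x) t a b (sqImbalance c g (t - + 2 * b) xs) (sqImbalance c g t ys) ⟩
  c x * ((t - + 2 * b - + 2 * a) * (t - + 2 * b - + 2 * a)) + sqImbalance c g (t - + 2 * b) xs + sqImbalance c g t ys ∎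
  where
  q = t - + 2 * weight g (xs ++ ys)
  a = weight g xs
  b = weight g ys
  regroup : ∀ c t a b r s →
    c * ((t - + 2 * (a + b)) * (t - + 2 * (a + b))) + (r + s) ≡ c * ((t - + 2 * b - + 2 * a) * (t - + 2 * b - + 2 * a)) + r + s
  regroup = solve-∀

sqImbalance-flat : ∀ {c g} t {w} → All (λ x → g x ≡ + 0) w → sqImbalance c g t w ≡ weight c w * (t * t)
sqImbalance-flat t [] = refl
sqImbalance-flat {c} {g} t {x ∷ s} (_ ∷ p) =
  trans (cong₂ (λ h r → c x * ((t - + 2 * h) * (t - + 2 * h)) + r) (weight-vanishing p) (sqImbalance-flat t p))
        (step (c x) t (weight c s))
  where
  step : ∀ a t v → a * ((t - + 2 * + 0) * (t - + 2 * + 0)) + v * (t * t) ≡ (a + v) * (t * t)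
  step = solve-∀

sqImbalance-vanishing : ∀ {c g t w} → All (λ x → c x ≡ + 0) w → sqImbalance c g t w ≡ + 0
sqImbalance-vanishing []         = refl
sqImbalance-vanishing {g = g} {t} {x ∷ s} (cx≡0 ∷ p) =
  cong₂ _+_ (cong (_* ((t - + 2 * weight g s) * (t - + 2 * weight g s))) cx≡0) (sqImbalance-vanishing p)

square-nonneg : ∀ z → + 0 ≤ z * z
square-nonneg (+ n)    = subst (+ 0 ≤_) (pos-* n n) (+≤+ z≤n)
square-nonneg -[1+ n ] = +≤+ z≤n

oblong-nonneg : ∀ j → + 0 ≤ j * j + j
oblong-nonneg (+ n)    = subst (+ 0 ≤_) (trans (pos-+ (n ℕ.* n) n) (cong (_+ + n) (pos-* n n))) (+≤+ z≤n)
oblong-nonneg -[1+ n ] = subst (+ 0 ≤_) (trans (pos-* (suc n) n) (sym (negate (+ n)))) (+≤+ z≤n)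
  where
  negate : ∀ i → - (+ 1 + i) * - (+ 1 + i) + - (+ 1 + i) ≡ (+ 1 + i) * i
  negate = solve-∀

odd-square : ∀ j → + 1 ≤ (+ 1 + + 2 * j) * (+ 1 + + 2 * j)
odd-square j = subst (+ 1 ≤_) (sym (expand j)) (+-monoʳ-≤ (+ 1) (*-monoˡ-≤-nonNeg (+ 4) (oblong-nonneg j)))
  where
  expand : ∀ j → (+ 1 + + 2 * j) * (+ 1 + + 2 * j) ≡ + 1 + + 4 * (j * j + j)
  expand = solve-∀

square≤0 : ∀ z → z * z ≤ + 0 → z ≡ + 0
square≤0 (+ zero)  _       = refl
square≤0 +[1+ n ]  (+≤+ ())
square≤0 -[1+ n ]  (+≤+ ())

sqImbalance-nonneg : ∀ c g t w → (∀ x → NonNegative (c x)) → + 0 ≤ sqImbalance c g t w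
sqImbalance-nonneg c g t []      _  = +≤+ z≤n
sqImbalance-nonneg c g t (x ∷ s) nn =
  +-mono-≤ (subst (_≤ c x * (q * q)) (*-zeroʳ (c x)) (*-monoˡ-≤-nonNeg (c x) {{nn x}} (square-nonneg q)))
           (sqImbalance-nonneg c g t s nn)
  where
  q = t - + 2 * weight g s

sqImbalance-odd : ∀ c g j w → (∀ x → NonNegative (c x)) → weight c w ≤ sqImbalance c g (+ 1 + + 2 * j) w
sqImbalance-odd c g j []      _  = +≤+ z≤n
sqImbalance-odd c g j (x ∷ s) nn = +-mono-≤ term≥ (sqImbalance-odd c g j s nn)
  where
  h = weight g s
  recentre : ∀ j h → + 1 + + 2 * j - + 2 * h ≡ + 1 + + 2 * (j - h)
  recentre = solve-∀
  term≥ : c x ≤ c x * ((+ 1 + + 2 * j - + 2 * h) * (+ 1 + + 2 * j - + 2 * h))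
  term≥ = subst₂ _≤_ (*-identityʳ (c x)) (cong (λ z → c x * (z * z)) (sym (recentre j h)))
                 (*-monoˡ-≤-nonNeg (c x) {{nn x}} (odd-square (j - h)))

-- A closed formula for m3

countMonotone : List (List Letter) → ℕ
countMonotone us = length (filter monotone? us)

countMonotone-++ : ∀ us vs → countMonotone (us ++ vs) ≡ countMonotone us ℕ.+ countMonotone vs
countMonotone-++ us vs = trans (cong length (filter-++ monotone? us vs)) (length-++ (filter monotone? us))

extensions : Letter → List Letter → ℕ
extensions x w = countMonotone (map (x ∷_) (subwords 2 w))

m3-∷ : ∀ x w → m3 (x ∷ w) ≡ extensions x w ℕ.+ m3 w
m3-∷ x w = countMonotone-++ (map (x ∷_) (subwords 2 w)) (subwords 3 w)

pairExtensions : Letter → Letter → List Letter → ℕ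
pairExtensions x y w = countMonotone (map (x ∷_) (map (y ∷_) (subwords 1 w)))

extensions-∷ : ∀ x y w → extensions x (y ∷ w) ≡ pairExtensions x y w ℕ.+ extensions x w
extensions-∷ x y w = trans (cong countMonotone (map-++ (x ∷_) (map (y ∷_) (subwords 1 w)) (subwords 2 w)))
                           (countMonotone-++ (map (x ∷_) (map (y ∷_) (subwords 1 w))) (map (x ∷_) (subwords 2 w)))

isMonotone3 : Letter → Letter → Letter → ℤ
isMonotone3 x y z = + countMonotone [ x ∷ y ∷ z ∷ [] ]

pairExtensions≡weight : ∀ x y w → + pairExtensions x y w ≡ weight (isMonotone3 x y) w
pairExtensions≡weight x y [] = refl
pairExtensions≡weight x y (z ∷ w) = begin
  + pairExtensions x y (z ∷ w)                     ≡⟨ cong +_ (countMonotone-++ [ x ∷ y ∷ z ∷ [] ] _) ⟩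
  + (countMonotone [ x ∷ y ∷ z ∷ [] ] ℕ.+ pairExtensions x y w)
                                                   ≡⟨ pos-+ (countMonotone [ x ∷ y ∷ z ∷ [] ]) (pairExtensions x y w) ⟩
  isMonotone3 x y z + + pairExtensions x y w       ≡⟨ cong (_+_ (isMonotone3 x y z)) (pairExtensions≡weight x y w) ⟩
  weight (isMonotone3 x y) (z ∷ w)                 ∎

-- The polynomials below are INLINE so that the ring solver sees through them; once the letters are
-- fixed by a case split, all letter weights reduce to numerals, which the solver treats as constants.
extensionsPoly : Letter → (d m e i₁ i₂ i₃ : ℤ) → ℤ
extensionsPoly x d m e i₁ i₂ i₃ =
  (+ 2 + notOne x) * m * m + (+ 1 + isOne x) * d * d + + 4 * e * e + + 4 * m * e - + 4 * m - + 4 * e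
    + sign x * (+ 2 * i₁ + + 4 * i₂ - + 2 * d) + + 4 * isOne x * i₃
{-# INLINE extensionsPoly #-}

extensionsPoly-∷ : ∀ x y (d m e i₁ i₂ i₃ : ℤ) →
  + 4 * ((isMonotone3 x y l0 + isMonotone3 x y l2) * m + (isMonotone3 x y l0 - isMonotone3 x y l2) * d
          + + 2 * isMonotone3 x y l1 * e)
    + extensionsPoly x d m e i₁ i₂ i₃
  ≡ extensionsPoly x (sign y + d) (notOne y + m) (isOne y + e)
      (notOne y * (sign y + d - + 2 * d) + (i₁ + sign y * m))
      (isOne y * (sign y + d - + 2 * d) + (i₂ + sign y * e))
      (notOne y * (isOne y + e - + 2 * e) + (i₃ + isOne y * m))
extensionsPoly-∷ zero             zero             = solve-∀
extensionsPoly-∷ zero             (suc zero)       = solve-∀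
extensionsPoly-∷ zero             (suc (suc zero)) = solve-∀
extensionsPoly-∷ (suc zero)       zero             = solve-∀
extensionsPoly-∷ (suc zero)       (suc zero)       = solve-∀
extensionsPoly-∷ (suc zero)       (suc (suc zero)) = solve-∀
extensionsPoly-∷ (suc (suc zero)) zero             = solve-∀
extensionsPoly-∷ (suc (suc zero)) (suc zero)       = solve-∀
extensionsPoly-∷ (suc (suc zero)) (suc (suc zero)) = solve-∀

extensionsPoly-cong : ∀ x {d m e i₁ i₂ i₃ j₁ j₂ j₃} → i₁ ≡ j₁ → i₂ ≡ j₂ → i₃ ≡ j₃ →
  extensionsPoly x d m e i₁ i₂ i₃ ≡ extensionsPoly x d m e j₁ j₂ j₃
extensionsPoly-cong x refl refl refl = refl

extensions-formula : ∀ x w →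
  + 8 * + extensions x w
    ≡ extensionsPoly x (height w) (weight notOne w) (weight isOne w)
        (imbalance notOne sign (height w) w) (imbalance isOne sign (height w) w)
        (imbalance notOne isOne (weight isOne w) w)
extensions-formula zero             [] = refl
extensions-formula (suc zero)       [] = refl
extensions-formula (suc (suc zero)) [] = refl
extensions-formula x (y ∷ w) = begin
  + 8 * + extensions x (y ∷ w)
    ≡⟨ cong (λ n → + 8 * + n) (extensions-∷ x y w) ⟩
  + 8 * + (pairExtensions x y w ℕ.+ extensions x w)
    ≡⟨ cong (+ 8 *_) (pos-+ (pairExtensions x y w) (extensions x w)) ⟩
  + 8 * (+ pairExtensions x y w + + extensions x w)
    ≡⟨ regroup (+ pairExtensions x y w) (+ extensions x w) ⟩
  + 4 * (+ 2 * + pairExtensions x y w) + + 8 * + extensions x w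
    ≡⟨ cong₂ (λ a b → + 4 * a + b)
             (trans (cong (+ 2 *_) (pairExtensions≡weight x y w)) (weight-decomposition (isMonotone3 x y) w))
             (extensions-formula x w) ⟩
  _ ≡⟨ extensionsPoly-∷ x y d m e i₁ i₂ i₃ ⟩
  _ ≡⟨ extensionsPoly-cong x (sym (imbalance-∷ notOne sign y d w)) (sym (imbalance-∷ isOne sign y d w))
                             (sym (imbalance-∷ notOne isOne y e w)) ⟩
  extensionsPoly x (height (y ∷ w)) (weight notOne (y ∷ w)) (weight isOne (y ∷ w))
    (imbalance notOne sign (height (y ∷ w)) (y ∷ w)) (imbalance isOne sign (height (y ∷ w)) (y ∷ w))
    (imbalance notOne isOne (weight isOne (y ∷ w)) (y ∷ w)) ∎
  where
  d = height w
  m = weight notOne w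
  e = weight isOne w
  i₁ = imbalance notOne sign d w
  i₂ = imbalance isOne sign d w
  i₃ = imbalance notOne isOne e w
  regroup : ∀ a b → + 8 * (a + b) ≡ + 4 * (+ 2 * a) + + 8 * b
  regroup = solve-∀

cubic : ℤ → ℤ → ℤ
cubic m e = + 6 * m * (m - + 2) * (m - + 2) - + 12 * m + + 12 * m * e * (m + e - + 4) + + 8 * e * (e - + 1) * (e - + 2)
{-# INLINE cubic #-}

m3Poly : (m e q₁ q₂ q₃ : ℤ) → ℤ
m3Poly m e q₁ q₂ q₃ = cubic m e + + 6 * q₁ + + 12 * q₂ + + 12 * q₃
{-# INLINE m3Poly #-}

m3Poly-∷ : ∀ x (d m e i₁ i₂ i₃ q₁ q₂ q₃ : ℤ) →
  + 6 * extensionsPoly x d m e i₁ i₂ i₃ + m3Poly m e q₁ q₂ q₃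
  ≡ m3Poly (notOne x + m) (isOne x + e)
      (notOne x * ((sign x + d - + 2 * d) * (sign x + d - + 2 * d)) + (q₁ + + 2 * sign x * i₁ + sign x * sign x * m))
      (isOne x * ((sign x + d - + 2 * d) * (sign x + d - + 2 * d)) + (q₂ + + 2 * sign x * i₂ + sign x * sign x * e))
      (notOne x * ((isOne x + e - + 2 * e) * (isOne x + e - + 2 * e)) + (q₃ + + 2 * isOne x * i₃ + isOne x * isOne x * m))
m3Poly-∷ zero             = solve-∀
m3Poly-∷ (suc zero)       = solve-∀
m3Poly-∷ (suc (suc zero)) = solve-∀

m3Poly-cong : ∀ m e {q₁ q₂ q₃ q₁′ q₂′ q₃′} → q₁ ≡ q₁′ → q₂ ≡ q₂′ → q₃ ≡ q₃′ →
  m3Poly m e q₁ q₂ q₃ ≡ m3Poly m e q₁′ q₂′ q₃′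
m3Poly-cong m e refl refl refl = refl

m3-formula : ∀ w →
  + 48 * + m3 w
    ≡ m3Poly (weight notOne w) (weight isOne w)
        (heightImbalance notOne w) (heightImbalance isOne w) (onesImbalance w)
m3-formula [] = refl
m3-formula (x ∷ w) = begin
  + 48 * + m3 (x ∷ w)
    ≡⟨ cong (λ n → + 48 * + n) (m3-∷ x w) ⟩
  + 48 * + (extensions x w ℕ.+ m3 w)
    ≡⟨ cong (+ 48 *_) (pos-+ (extensions x w) (m3 w)) ⟩
  + 48 * (+ extensions x w + + m3 w)
    ≡⟨ regroup (+ extensions x w) (+ m3 w) ⟩
  + 6 * (+ 8 * + extensions x w) + + 48 * + m3 w
    ≡⟨ cong₂ (λ a b → + 6 * a + b) (extensions-formula x w) (m3-formula w) ⟩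
  _ ≡⟨ m3Poly-∷ x d m e (imbalance notOne sign d w) (imbalance isOne sign d w) (imbalance notOne isOne e w)
               (sqImbalance notOne sign d w) (sqImbalance isOne sign d w) (sqImbalance notOne isOne e w) ⟩
  _ ≡⟨ m3Poly-cong (notOne x + m) (isOne x + e)
                   (sym (sqImbalance-∷ notOne sign x d w)) (sym (sqImbalance-∷ isOne sign x d w))
                   (sym (sqImbalance-∷ notOne isOne x e w)) ⟩
  m3Poly (weight notOne (x ∷ w)) (weight isOne (x ∷ w))
    (heightImbalance notOne (x ∷ w)) (heightImbalance isOne (x ∷ w)) (onesImbalance (x ∷ w)) ∎
  where
  d = height w
  m = weight notOne w
  e = weight isOne w
  regroup : ∀ a b → + 48 * (a + b) ≡ + 6 * (+ 8 * a) + + 48 * b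
  regroup = solve-∀

m3Poly-mono : ∀ m e {q₁ q₂ q₁′ q₂′} q₃ → q₁ ≤ q₁′ → q₂ ≤ q₂′ → m3Poly m e q₁ q₂ q₃ ≤ m3Poly m e q₁′ q₂′ q₃
m3Poly-mono m e q₃ q₁≤ q₂≤ =
  +-mono-≤ (+-mono-≤ (+-monoʳ-≤ (cubic m e) (*-monoˡ-≤-nonNeg (+ 6) q₁≤)) (*-monoˡ-≤-nonNeg (+ 12) q₂≤)) ≤-refl

m3Poly-cancel : ∀ m e q₁ q₂ {q₃ q₃′} → m3Poly m e q₁ q₂ q₃ ≤ m3Poly m e q₁ q₂ q₃′ → q₃ ≤ q₃′
m3Poly-cancel m e q₁ q₂ {q₃} {q₃′} h = *-cancelˡ-≤-pos q₃ q₃′ (+ 12) (+-cancelˡ-≤ (cubic m e + + 6 * q₁ + + 12 * q₂) h)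
  where
  cancel : ∀ a b → - a + (a + b) ≡ b
  cancel = solve-∀
  +-cancelˡ-≤ : ∀ a {b c} → a + b ≤ a + c → b ≤ c
  +-cancelˡ-≤ a {b} {c} le = subst₂ _≤_ (cancel a b) (cancel a c) (+-monoʳ-≤ (- a) le)

m3-lower : ∀ w k → weight notOne w ≡ + 1 + + 2 * + k →
  m3Poly (weight notOne w) (weight isOne w) (weight notOne w) (weight isOne w) (onesImbalance w)
    ≤ + 48 * + m3 w
m3-lower w k others≡ =
  ≤-trans (m3Poly-mono m e (onesImbalance w) (atOdd notOne notOne-nonneg) (atOdd isOne isOne-nonneg))
          (≤-reflexive (sym (m3-formula w)))
  where
  m = weight notOne w
  e = weight isOne w
  o₂ = + occ l2 w
  odd : height w ≡ + 1 + + 2 * (+ k - o₂)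
  odd = begin
    height w                        ≡⟨ unshift (height w) o₂ ⟩
    height w + + 2 * o₂ - + 2 * o₂  ≡⟨ cong (_- + 2 * o₂) (trans (sym (weight-notOne w)) others≡) ⟩
    + 1 + + 2 * + k - + 2 * o₂      ≡⟨ regroup (+ k) o₂ ⟩
    + 1 + + 2 * (+ k - o₂)          ∎
    where
    unshift : ∀ h o → h ≡ h + + 2 * o - + 2 * o
    unshift = solve-∀
    regroup : ∀ k o → + 1 + + 2 * k - + 2 * o ≡ + 1 + + 2 * (k - o)
    regroup = solve-∀
  atOdd : ∀ c → (∀ x → NonNegative (c x)) → weight c w ≤ heightImbalance c w
  atOdd c nn = subst (λ t → weight c w ≤ sqImbalance c sign t w) (sym odd) (sqImbalance-odd c sign (+ k - o₂) w nn)

-- The extremal word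

alternating : ℕ → List Letter
alternating zero    = l0 ∷ []
alternating (suc k) = l0 ∷ l2 ∷ alternating k

weight-alternating : ∀ c k → weight c (alternating k) ≡ c l0 + + k * (c l0 + c l2)
weight-alternating c zero    = refl
weight-alternating c (suc k) =
  trans (cong (λ r → c l0 + (c l2 + r)) (weight-alternating c k)) (step (c l0) (c l2) (+ k))
  where
  step : ∀ a b k → a + (b + (a + k * (a + b))) ≡ a + (+ 1 + k) * (a + b)
  step = solve-∀

height-alternating : ∀ k → height (alternating k) ≡ + 1
height-alternating k = trans (weight-alternating sign k) (balanced (+ k))
  where
  balanced : ∀ k → + 1 + k * (+ 1 + -[1+ 0 ]) ≡ + 1
  balanced = solve-∀

noOnes-alternating : ∀ k → All (λ x → isOne x ≡ + 0) (alternating k)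
noOnes-alternating zero    = refl ∷ []
noOnes-alternating (suc k) = refl ∷ refl ∷ noOnes-alternating k

sqImbalance-alternating : ∀ c k → sqImbalance c sign (+ 1) (alternating k) ≡ weight c (alternating k)
sqImbalance-alternating c zero    = cong (_+ + 0) (*-identityʳ (c l0))
sqImbalance-alternating c (suc k) =
  trans (cong₂ (λ h r → c l0 * ((+ 1 - + 2 * (-[1+ 0 ] + h)) * (+ 1 - + 2 * (-[1+ 0 ] + h)))
                          + (c l2 * ((+ 1 - + 2 * h) * (+ 1 - + 2 * h)) + r))
               (height-alternating k) (sqImbalance-alternating c k))
        (unitSquares (c l0) (c l2) (weight c (alternating k)))
  where
  unitSquares : ∀ a b r →
    a * ((+ 1 - + 2 * (-[1+ 0 ] + + 1)) * (+ 1 - + 2 * (-[1+ 0 ] + + 1))) + (b * ((+ 1 - + 2 * + 1) * (+ 1 - + 2 * + 1)) + r)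
      ≡ a + (b + r)
  unitSquares = solve-∀

extremal : ℕ → ℕ → List Letter
extremal y k = replicate y l1 ++ alternating k ++ replicate y l1

extremal-weight : ∀ c y k → weight c (extremal y k) ≡ + 2 * + y * c l1 + (c l0 + + k * (c l0 + c l2))
extremal-weight c y k = begin
  weight c (extremal y k)
    ≡⟨ weight-++ c (replicate y l1) (alternating k ++ replicate y l1) ⟩
  weight c (replicate y l1) + weight c (alternating k ++ replicate y l1)
    ≡⟨ cong (_+_ (weight c (replicate y l1))) (weight-++ c (alternating k) (replicate y l1)) ⟩
  weight c (replicate y l1) + (weight c (alternating k) + weight c (replicate y l1))
    ≡⟨ cong₂ (λ u v → u + (v + u)) (weight-replicate c y l1) (weight-alternating c k) ⟩
  + y * c l1 + (c l0 + + k * (c l0 + c l2) + + y * c l1)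
    ≡⟨ regroup (+ y) (c l1) (c l0 + + k * (c l0 + c l2)) ⟩
  + 2 * + y * c l1 + (c l0 + + k * (c l0 + c l2)) ∎
  where
  regroup : ∀ y c a → y * c + (a + y * c) ≡ + 2 * y * c + a
  regroup = solve-∀

others-extremal : ∀ y k → weight notOne (extremal y k) ≡ + 1 + + 2 * + k
others-extremal y k = trans (extremal-weight notOne y k) (evaluate (+ y) (+ k))
  where
  evaluate : ∀ y k → + 2 * y * + 0 + (+ 1 + k * (+ 1 + + 1)) ≡ + 1 + + 2 * k
  evaluate = solve-∀

ones-extremal : ∀ y k → weight isOne (extremal y k) ≡ + 2 * + y
ones-extremal y k = trans (extremal-weight isOne y k) (evaluate (+ y) (+ k))
  where
  evaluate : ∀ y k → + 2 * y * + 1 + (+ 0 + k * (+ 0 + + 0)) ≡ + 2 * y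
  evaluate = solve-∀

height-extremal : ∀ y k → height (extremal y k) ≡ + 1
height-extremal y k = trans (extremal-weight sign y k) (evaluate (+ y) (+ k))
  where
  evaluate : ∀ y k → + 2 * y * + 0 + (+ 1 + k * (+ 1 + -[1+ 0 ])) ≡ + 1
  evaluate = solve-∀

module _ (y k : ℕ) where
  private
    O = replicate y l1
    A = alternating k
    W = extremal y k

  heightImbalance-others-extremal : heightImbalance notOne W ≡ + 1 + + 2 * + k
  heightImbalance-others-extremal = begin
    sqImbalance notOne sign (height W) W
      ≡⟨ cong (λ t → sqImbalance notOne sign t W) (height-extremal y k) ⟩
    sqImbalance notOne sign (+ 1) (O ++ A ++ O)
      ≡⟨ sqImbalance-++ notOne sign (+ 1) O (A ++ O) ⟩
    sqImbalance notOne sign (+ 1 - + 2 * height (A ++ O)) O + sqImbalance notOne sign (+ 1) (A ++ O)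
      ≡⟨ cong₂ _+_ (sqImbalance-vanishing (replicate⁺ y refl)) (sqImbalance-++ notOne sign (+ 1) A O) ⟩
    + 0 + (sqImbalance notOne sign (+ 1 - + 2 * height O) A + sqImbalance notOne sign (+ 1) O)
      ≡⟨ cong₂ (λ h r → + 0 + (sqImbalance notOne sign (+ 1 - + 2 * h) A + r))
               (weight-vanishing (replicate⁺ y refl)) (sqImbalance-vanishing (replicate⁺ y refl)) ⟩
    + 0 + (sqImbalance notOne sign (+ 1) A + + 0)
      ≡⟨ cong (λ r → + 0 + (r + + 0)) (trans (sqImbalance-alternating notOne k) (weight-alternating notOne k)) ⟩
    + 0 + (+ 1 + + k * (+ 1 + + 1) + + 0)
      ≡⟨ evaluate (+ k) ⟩
    + 1 + + 2 * + k ∎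
    where
    evaluate : ∀ k → + 0 + (+ 1 + k * (+ 1 + + 1) + + 0) ≡ + 1 + + 2 * k
    evaluate = solve-∀

  heightImbalance-ones-extremal : heightImbalance isOne W ≡ + 2 * + y
  heightImbalance-ones-extremal = begin
    sqImbalance isOne sign (height W) W
      ≡⟨ cong (λ t → sqImbalance isOne sign t W) (height-extremal y k) ⟩
    sqImbalance isOne sign (+ 1) (O ++ A ++ O)
      ≡⟨ sqImbalance-++ isOne sign (+ 1) O (A ++ O) ⟩
    sqImbalance isOne sign (+ 1 - + 2 * height (A ++ O)) O + sqImbalance isOne sign (+ 1) (A ++ O)
      ≡⟨ cong₂ _+_ (sqImbalance-flat (+ 1 - + 2 * height (A ++ O)) (replicate⁺ y refl))
                   (sqImbalance-++ isOne sign (+ 1) A O) ⟩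
    weight isOne O * ((+ 1 - + 2 * height (A ++ O)) * (+ 1 - + 2 * height (A ++ O)))
      + (sqImbalance isOne sign (+ 1 - + 2 * height O) A + sqImbalance isOne sign (+ 1) O)
      ≡⟨ cong₂ (λ h r → weight isOne O * ((+ 1 - + 2 * h) * (+ 1 - + 2 * h)) + r) heightAO
               (cong₂ _+_ (sqImbalance-vanishing (noOnes-alternating k)) (sqImbalance-flat (+ 1) (replicate⁺ y refl))) ⟩
    weight isOne O * ((+ 1 - + 2 * + 1) * (+ 1 - + 2 * + 1)) + (+ 0 + weight isOne O * (+ 1 * + 1))
      ≡⟨ cong (λ e → e * ((+ 1 - + 2 * + 1) * (+ 1 - + 2 * + 1)) + (+ 0 + e * (+ 1 * + 1))) (weight-replicate isOne y l1) ⟩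
    + y * + 1 * ((+ 1 - + 2 * + 1) * (+ 1 - + 2 * + 1)) + (+ 0 + + y * + 1 * (+ 1 * + 1))
      ≡⟨ evaluate (+ y) ⟩
    + 2 * + y ∎
    where
    heightAO : height (A ++ O) ≡ + 1
    heightAO = trans (weight-++ sign A O) (cong₂ _+_ (height-alternating k) (weight-vanishing (replicate⁺ y refl)))
    evaluate : ∀ y → y * + 1 * ((+ 1 - + 2 * + 1) * (+ 1 - + 2 * + 1)) + (+ 0 + y * + 1 * (+ 1 * + 1)) ≡ + 2 * y
    evaluate = solve-∀

  onesImbalance-extremal : onesImbalance W ≡ + 0
  onesImbalance-extremal = begin
    sqImbalance notOne isOne (weight isOne W) W
      ≡⟨ cong (λ t → sqImbalance notOne isOne t W) (ones-extremal y k) ⟩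
    sqImbalance notOne isOne (+ 2 * + y) (O ++ A ++ O)
      ≡⟨ sqImbalance-++ notOne isOne (+ 2 * + y) O (A ++ O) ⟩
    sqImbalance notOne isOne (+ 2 * + y - + 2 * weight isOne (A ++ O)) O + sqImbalance notOne isOne (+ 2 * + y) (A ++ O)
      ≡⟨ cong₂ _+_ (sqImbalance-vanishing (replicate⁺ y refl)) (sqImbalance-++ notOne isOne (+ 2 * + y) A O) ⟩
    + 0 + (sqImbalance notOne isOne t A + sqImbalance notOne isOne (+ 2 * + y) O)
      ≡⟨ cong (_+_ (+ 0)) (cong₂ _+_ (sqImbalance-flat t (noOnes-alternating k)) (sqImbalance-vanishing (replicate⁺ y refl))) ⟩
    + 0 + (weight notOne A * (t * t) + + 0)
      ≡⟨ cong (λ e → + 0 + (weight notOne A * ((+ 2 * + y - + 2 * e) * (+ 2 * + y - + 2 * e)) + + 0))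
              (weight-replicate isOne y l1) ⟩
    + 0 + (weight notOne A * ((+ 2 * + y - + 2 * (+ y * + 1)) * (+ 2 * + y - + 2 * (+ y * + 1))) + + 0)
      ≡⟨ evaluate (weight notOne A) (+ y) ⟩
    + 0 ∎
    where
    t = + 2 * + y - + 2 * weight isOne O
    evaluate : ∀ a y → + 0 + (a * ((+ 2 * y - + 2 * (y * + 1)) * (+ 2 * y - + 2 * (y * + 1))) + + 0) ≡ + 0
    evaluate = solve-∀

m3-extremal : ∀ y k →
  + 48 * + m3 (extremal y k) ≡ m3Poly (+ 1 + + 2 * + k) (+ 2 * + y) (+ 1 + + 2 * + k) (+ 2 * + y) (+ 0)
m3-extremal y k = begin
  + 48 * + m3 W
    ≡⟨ m3-formula W ⟩
  m3Poly (weight notOne W) (weight isOne W)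
    (heightImbalance notOne W) (heightImbalance isOne W) (onesImbalance W)
    ≡⟨ m3Poly-cong (weight notOne W) (weight isOne W)
                   (heightImbalance-others-extremal y k) (heightImbalance-ones-extremal y k) (onesImbalance-extremal y k) ⟩
  m3Poly (weight notOne W) (weight isOne W) (+ 1 + + 2 * + k) (+ 2 * + y) (+ 0)
    ≡⟨ cong₂ (λ m e → m3Poly m e (+ 1 + + 2 * + k) (+ 2 * + y) (+ 0)) (others-extremal y k) (ones-extremal y k) ⟩
  m3Poly (+ 1 + + 2 * + k) (+ 2 * + y) (+ 1 + + 2 * + k) (+ 2 * + y) (+ 0) ∎
  where
  W = extremal y k

odd-split : ∀ n y → n % 2 ≡ 1 → 2 ℕ.* y ℕ.< n → ∃[ k ] + n ≡ + 1 + + 2 * + k + + 2 * + y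
odd-split n y odd 2y<n = k , (begin
  + n                         ≡⟨ cong +_ (trans n≡ (cong (λ q → suc (q ℕ.* 2)) (sym (ℕ.m+[n∸m]≡n y≤q)))) ⟩
  + 1 + + ((y ℕ.+ k) ℕ.* 2)   ≡⟨ cong (_+_ (+ 1)) (trans (pos-* (y ℕ.+ k) 2) (cong (_* + 2) (pos-+ y k))) ⟩
  + 1 + (+ y + + k) * + 2     ≡⟨ regroup (+ y) (+ k) ⟩
  + 1 + + 2 * + k + + 2 * + y ∎)
  where
  q = n / 2
  k = q ∸ y
  n≡ : n ≡ suc (q ℕ.* 2)
  n≡ = trans (m≡m%n+[m/n]*n n 2) (cong (ℕ._+ q ℕ.* 2) odd)
  y≤q : y ℕ.≤ q
  y≤q = ℕ.*-cancelʳ-≤ y q 2 (subst (ℕ._≤ q ℕ.* 2) (ℕ.*-comm 2 y) (ℕ.s≤s⁻¹ (subst (2 ℕ.* y ℕ.<_) n≡ 2y<n)))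
  regroup : ∀ y k → + 1 + (y + k) * + 2 ≡ + 1 + + 2 * k + + 2 * y
  regroup = solve-∀

extremal-InSet : ∀ n y k → + n ≡ + 1 + + 2 * + k + + 2 * + y → InSet n y (extremal y k)
extremal-InSet n y k n≡ = +-injective lengthW , +-injective onesW , ℕ.≤-reflexive (+-injective zerosW)
  where
  W = extremal y k
  lengthW : + length W ≡ + n
  lengthW = trans (sym (weight-notOne+isOne W)) (trans (cong₂ _+_ (others-extremal y k) (ones-extremal y k)) (sym n≡))
  onesW : + occ l1 W ≡ + (2 ℕ.* y)
  onesW = trans (sym (weight-isOne W)) (trans (ones-extremal y k) (sym (pos-* 2 y)))
  zerosW : + suc (occ l2 W) ≡ + occ l0 W
  zerosW = trans (cong (_+ + occ l2 W) (sym (height-extremal y k))) (height+occ₂ W)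

Balanced : ℕ → List Letter → Set
Balanced y []                   = ⊤
Balanced y (zero ∷ w)           = occ l1 w ≡ y × Balanced y w
Balanced y (suc zero ∷ w)       = Balanced y w
Balanced y (suc (suc zero) ∷ w) = occ l1 w ≡ y × Balanced y w

nonneg-sum≤0 : ∀ {a b} → + 0 ≤ a → + 0 ≤ b → a + b ≤ + 0 → a ≤ + 0 × b ≤ + 0
nonneg-sum≤0 {a} {b} 0≤a 0≤b a+b≤0 =
  ≤-trans (i≤i+j a b {{nonNegative 0≤b}}) a+b≤0 , ≤-trans (i≤j+i b a {{nonNegative 0≤a}}) a+b≤0

sqImbalance≤0⇒Balanced : ∀ y w → sqImbalance notOne isOne (+ 2 * + y) w ≤ + 0 → Balanced y w

balanced-after-other : ∀ y s →
  + 1 * ((+ 2 * + y - + 2 * weight isOne s) * (+ 2 * + y - + 2 * weight isOne s)) + sqImbalance notOne isOne (+ 2 * + y) s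
    ≤ + 0 →
  occ l1 s ≡ y × Balanced y s
balanced-after-other y s h = onesAfter , sqImbalance≤0⇒Balanced y s (proj₂ parts)
  where
  q = + 2 * + y - + 2 * weight isOne s
  parts = nonneg-sum≤0 (subst (+ 0 ≤_) (sym (*-identityˡ (q * q))) (square-nonneg q))
                       (sqImbalance-nonneg notOne isOne (+ 2 * + y) s notOne-nonneg) h
  2y≡2ones : + 2 * + y ≡ + 2 * weight isOne s
  2y≡2ones = i-j≡0⇒i≡j _ _ (square≤0 q (subst (_≤ + 0) (*-identityˡ (q * q)) (proj₁ parts)))
  onesAfter : occ l1 s ≡ y
  onesAfter = +-injective (sym (trans (*-cancelˡ-≡ (+ 2) (+ y) (weight isOne s) 2y≡2ones) (weight-isOne s)))

sqImbalance≤0⇒Balanced y []                   _ = tt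
sqImbalance≤0⇒Balanced y (zero ∷ s)           h = balanced-after-other y s h
sqImbalance≤0⇒Balanced y (suc zero ∷ s)       h = sqImbalance≤0⇒Balanced y s (subst (_≤ + 0) (+-identityˡ _) h)
sqImbalance≤0⇒Balanced y (suc (suc zero) ∷ s) h = balanced-after-other y s h

balanced-y≤occ : ∀ {y} w → Balanced y w → occ l1 w ℕ.< length w → y ℕ.≤ occ l1 w
balanced-y≤occ (zero ∷ w)           (y≡ , _) _       = ℕ.≤-reflexive (sym y≡)
balanced-y≤occ (suc zero ∷ w)       b        (s≤s h) = ℕ.m≤n⇒m≤1+n (balanced-y≤occ w b h)
balanced-y≤occ (suc (suc zero) ∷ w) (y≡ , _) _       = ℕ.≤-reflexive (sym y≡)

onlyOnes : ∀ w → occ l1 w ≡ length w → w ≡ replicate (length w) l1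
onlyOnes []                   _ = refl
onlyOnes (zero ∷ w)           h = ⊥-elim (ℕ.1+n≰n (subst (ℕ._≤ length w) h (length-filter (_≟ l1) w)))
onlyOnes (suc zero ∷ w)       h = cong (l1 ∷_) (onlyOnes w (ℕ.suc-injective h))
onlyOnes (suc (suc zero) ∷ w) h = ⊥-elim (ℕ.1+n≰n (subst (ℕ._≤ length w) h (length-filter (_≟ l1) w)))

deleteOnes-replicate : ∀ j → deleteOnes (replicate j l1) ≡ []
deleteOnes-replicate zero    = refl
deleteOnes-replicate (suc j) = deleteOnes-replicate j

balanced-suffix : ∀ {y} w → Balanced y w → occ l1 w ≡ y → w ≡ deleteOnes w ++ replicate y l1
balanced-suffix []                   _       refl = refl
balanced-suffix (zero ∷ w)           (_ , b) h    = cong (l0 ∷_) (balanced-suffix w b h)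
balanced-suffix (suc (suc zero) ∷ w) (_ , b) h    = cong (l2 ∷_) (balanced-suffix w b h)
balanced-suffix {y} (suc zero ∷ w)   b       h with occ l1 w ℕ.<? length w
... | yes hasOther = ⊥-elim (ℕ.1+n≰n (subst (ℕ._≤ occ l1 w) (sym h) (balanced-y≤occ w b hasOther)))
... | no  noOther  = begin
  l1 ∷ w                           ≡⟨ cong (l1 ∷_) ones ⟩
  replicate (suc (length w)) l1    ≡⟨ cong (λ j → replicate j l1) (trans (cong suc (sym allOnes)) h) ⟩
  replicate y l1                   ≡⟨ cong (_++ replicate y l1) (sym (trans (cong deleteOnes ones) (deleteOnes-replicate (length w)))) ⟩
  deleteOnes w ++ replicate y l1   ∎
  where
  allOnes : occ l1 w ≡ length w
  allOnes = ℕ.≤-antisym (length-filter (_≟ l1) w) (ℕ.≮⇒≥ noOther)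
  ones : w ≡ replicate (length w) l1
  ones = onlyOnes w allOnes

balanced-shape : ∀ {y} j w → Balanced y w → occ l1 w ≡ j ℕ.+ y → occ l1 w ℕ.< length w →
  w ≡ replicate j l1 ++ deleteOnes w ++ replicate y l1
balanced-shape zero    w                    b        h _       = balanced-suffix w b h
balanced-shape (suc j) (zero ∷ w)           (y≡ , _) h _       = ⊥-elim (ℕ.m≢1+n+m _ (trans (sym y≡) h))
balanced-shape (suc j) (suc zero ∷ w)       b        h (s≤s l) = cong (l1 ∷_) (balanced-shape j w b (ℕ.suc-injective h) l)
balanced-shape (suc j) (suc (suc zero) ∷ w) (y≡ , _) h _       = ⊥-elim (ℕ.m≢1+n+m _ (trans (sym y≡) h))

word-profile : ∀ n y k w → + n ≡ + 1 + + 2 * + k + + 2 * + y → length w ≡ n → occ l1 w ≡ 2 ℕ.* y →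
  weight notOne w ≡ + 1 + + 2 * + k × weight isOne w ≡ + 2 * + y
word-profile n y k w n≡ length≡ occ≡ = others≡ , ones≡
  where
  ones≡ : weight isOne w ≡ + 2 * + y
  ones≡ = trans (weight-isOne w) (trans (cong +_ occ≡) (pos-* 2 y))
  unshift : ∀ m e → m ≡ m + e - e
  unshift = solve-∀
  cancel : ∀ k y → + 1 + + 2 * k + + 2 * y - + 2 * y ≡ + 1 + + 2 * k
  cancel = solve-∀
  others≡ : weight notOne w ≡ + 1 + + 2 * + k
  others≡ = begin
    weight notOne w                                     ≡⟨ unshift (weight notOne w) (weight isOne w) ⟩
    weight notOne w + weight isOne w - weight isOne w   ≡⟨ cong₂ _-_ (trans (weight-notOne+isOne w) (trans (cong +_ length≡) n≡)) ones≡ ⟩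
    + 1 + + 2 * + k + + 2 * + y - + 2 * + y             ≡⟨ cancel (+ k) (+ y) ⟩
    + 1 + + 2 * + k                                     ∎

minimal⇒sqImbalance≤0 : ∀ y k w → weight notOne w ≡ + 1 + + 2 * + k → weight isOne w ≡ + 2 * + y →
  m3 w ℕ.≤ m3 (extremal y k) → sqImbalance notOne isOne (+ 2 * + y) w ≤ + 0
minimal⇒sqImbalance≤0 y k w others≡ ones≡ minimal = m3Poly-cancel M E M E (≤-trans lower upper)
  where
  M = + 1 + + 2 * + k
  E = + 2 * + y
  lower : m3Poly M E M E (sqImbalance notOne isOne E w) ≤ + 48 * + m3 w
  lower = ≤-trans (≤-reflexive (cong₂ (λ m e → m3Poly m e m e (sqImbalance notOne isOne e w)) (sym others≡) (sym ones≡)))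
                  (m3-lower w k others≡)
  upper : + 48 * + m3 w ≤ m3Poly M E M E (+ 0)
  upper = ≤-trans (*-monoˡ-≤-nonNeg (+ 48) (+≤+ minimal)) (≤-reflexive (m3-extremal y k))

lemma2p2 : (y n : ℕ) → n % 2 ≡ 1 → 2 ℕ.* y ℕ.< n →
    (w : List Letter) → InSet n y w →
    ((w' : List Letter) → InSet n y w' → m3 w ℕ.≤ m3 w') →
    ConsecutiveIn (deleteOnes w) w
      × (∃[ r ] (w ≡ replicate y l1 ++ r))
      × (∃[ r ] (w ≡ r ++ replicate y l1))
lemma2p2 y n odd 2y<n w (length≡ , occ≡ , _) minimal =
  (replicate y l1 , replicate y l1 , shape) ,
  (deleteOnes w ++ replicate y l1 , shape) ,
  (replicate y l1 ++ deleteOnes w , trans shape (sym (++-assoc (replicate y l1) (deleteOnes w) (replicate y l1))))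
  where
  k = proj₁ (odd-split n y odd 2y<n)
  n≡ = proj₂ (odd-split n y odd 2y<n)
  profile = word-profile n y k w n≡ length≡ occ≡
  balanced : Balanced y w
  balanced = sqImbalance≤0⇒Balanced y w (minimal⇒sqImbalance≤0 y k w (proj₁ profile) (proj₂ profile)
                                           (minimal (extremal y k) (extremal-InSet n y k n≡)))
  shape : w ≡ replicate y l1 ++ deleteOnes w ++ replicate y l1
  shape = balanced-shape y w balanced (trans occ≡ (cong (y ℕ.+_) (ℕ.+-identityʳ y))) (subst₂ ℕ._<_ (sym occ≡) (sym length≡) 2y<n)
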